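{- For every positive integer $n$, the final pair $\langle \mathsf{sr}(n), y_{\mathsf{sr}(n)}\rangle$ of $\mathsf{Alist}_n$ satisfies $\mathsf{sr}(n) = y_{\mathsf{sr}(n)}$.
   Context: For $n \in \{1,2,\ldots\}$, $\mathsf{Alist}_n$ is the sequence of integer pairs produced as follows: begin with $\langle 1, n\rangle$. Given the current pair $\langle i, y_i\rangle$ with $y_i > i$, the next pair is $\langle i+1, y_{i+1}\rangle$, where $y_{i+1}$ is the smallest integer with $(i+1)y_{i+1} > i(y_i+1)$. Stop when the current pair $\langle i,y_i\rangle$ satisfies $y_i \leq i$. This process terminates after finitely many steps; its final pair is denoted $\langle \mathsf{sr}(n), y_{\mathsf{sr}(n)}\rangle$, and $\mathsf{sr}(n)$ is called the strange root of $n$. -}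

module Defs where

open import Data.Nat using (ℕ; suc; _+_; _*_; _≤_; _<_)
open import Data.Product using (_×_)

IsNextY : ℕ → ℕ → ℕ → Set
IsNextY i y y' =
  (i * suc y < suc i * y') × (∀ w → i * suc y < suc i * w → y' ≤ w)

data AlistReaches : ℕ → ℕ → ℕ → ℕ → Set where
  stop : ∀ {i y} → y ≤ i → AlistReaches i y i y
  step : ∀ {i y y' k z} → i < y → IsNextY i y y' →
         AlistReaches (suc i) y' k z → AlistReaches i y k z

-- FinalPair n k z : ⟨k , z⟩ = ⟨sr(n) , y_sr(n)⟩ is the final pair of Alist_n
FinalPair : ℕ → ℕ → ℕ → Set
FinalPair n k z = AlistReaches 1 n k z

{-# OPTIONS --safe #-}
-- The pairs never drop below the diagonal: if i < y then (i+1) y' > i (y+1) ≥ (i+1) i,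
-- so y' > i, i.e. i+1 ≤ y'. Hence the first pair with y ≤ i lies on the diagonal.
module Submission where

open import Defs
open import Data.Nat using (ℕ; suc; _*_; _≤_; _<_)
open import Data.Nat.Properties
  using (≤-antisym; ≤-trans; ≤-reflexive; ≤-<-trans; *-monoʳ-≤; *-comm; *-cancelˡ-<; n≤1+n)
open import Data.Product using (_,_)
open import Relation.Binary.PropositionalEquality using (_≡_)

next-above-diagonal : ∀ {i y y'} → i < y → i * suc y < suc i * y' → i < y'
next-above-diagonal {i} {y} {y'} i<y next =
  *-cancelˡ-< (suc i) i y' (≤-<-trans [1+i]*i≤i*[1+y] next)
  where
    [1+i]*i≤i*[1+y] : suc i * i ≤ i * suc y
    [1+i]*i≤i*[1+y] =
      ≤-trans (≤-reflexive (*-comm (suc i) i)) (*-monoʳ-≤ i (≤-trans i<y (n≤1+n y)))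

reaches-diagonal : ∀ {i y k z} → AlistReaches i y k z → i ≤ y → k ≡ z
reaches-diagonal (stop y≤i)                 i≤y = ≤-antisym i≤y y≤i
reaches-diagonal (step i<y (next , _) rest) _   = reaches-diagonal rest (next-above-diagonal i<y next)

lemma2p3 : ∀ (n : ℕ) → 1 ≤ n → ∀ (k z : ℕ) → FinalPair n k z → k ≡ z
lemma2p3 n 1≤n k z final = reaches-diagonal final 1≤n
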